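{- Let $S\subseteq\mathbb{Z}^+$ with $1\in S$, $r\ge0$, and $n\ge1$. Let $T(j,k)$ denote the $(j,k)$ entry of the inverse matrix $\mathbb{T}_{S,r}=\mathbb{M}_{S,r}^{ -1}$. Then $$B_{n,S,r}(x)=(-1)^n\det\big(D\big),$$ where $D$ is the $(n+1)\times(n+1)$ matrix with rows and columns indexed by $0,\dots,n$, whose row $0$ is $(1,x,x^2,\dots,x^n)$ and whose row $k+1$ (for $k=0,\dots,n-1$) is $(T(0,k),T(1,k),\dots,T(n,k))$.
   Context: ${n\brace k}_{S,r}$ is the number of partitions of $[n+r]$ into $k+r$ non-empty blocks with $1,\dots,r$ in distinct blocks and all block sizes in $S$. $\mathbb{M}_{S,r}=\big[{n\brace k}_{S,r}\big]_{n,k\ge0}$ is lower triangular with unit diagonal when $1\in S$, hence invertible; $\mathbb{T}_{S,r}$ is its inverse. The $(S,r)$-Bell polynomial is $B_{n,S,r}(x)=\sum_{k=0}^n{n\brace k}_{S,r}x^k$. (Since $T$ is lower triangular with unit diagonal, row $k+1$ of $D$ has entries $0$ in columns $j<k$ and $1$ in column $k$.) -}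

module Defs where

open import Data.Bool using (Bool; true; false; _∧_; if_then_else_; _≟_)
open import Data.Nat as ℕ using (ℕ; zero; suc; _≤ᵇ_; _≡ᵇ_)
open import Data.Integer as ℤ using (ℤ; +_; -_; _*_; _+_; _^_)
open import Data.List using (List; []; _∷_; [_]; length; map; concatMap; filter)
open import Data.Fin using (Fin; toℕ; punchIn) renaming (zero to fzero; suc to fsuc)
open import Relation.Binary.PropositionalEquality using (_≡_)
open import Relation.Nullary.Decidable using (does)
open import Relation.Nullary using (yes; no)

-- A set partition of {1,…,m} is represented as a list of blocks,
-- each block a list of elements.

insertElem : ℕ → List (List ℕ) → List (List (List ℕ))
insertElem x [] = [ [ [ x ] ] ]
insertElem x (b ∷ bs) = ((x ∷ b) ∷ bs) ∷ map (b ∷_) (insertElem x bs)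

partitions : ℕ → List (List (List ℕ))
partitions zero = [ [] ]
partitions (suc m) = concatMap (insertElem (suc m)) (partitions m)

countLe : ℕ → List ℕ → ℕ
countLe r [] = zero
countLe r (y ∷ ys) = if y ≤ᵇ r then suc (countLe r ys) else countLe r ys

allB : {A : Set} → (A → Bool) → List A → Bool
allB P [] = true
allB P (a ∷ as) = P a ∧ allB P as

admissible : (ℕ → Bool) → ℕ → ℕ → List (List ℕ) → Bool
admissible S r k p =
  (length p ≡ᵇ (k ℕ.+ r)) ∧ (allB (λ b → S (length b)) p ∧ allB (λ b → countLe r b ≤ᵇ 1) p)

stirlingSr : (ℕ → Bool) → ℕ → ℕ → ℕ → ℕ
stirlingSr S r n k = length (filter (λ p → admissible S r k p ≟ true) (partitions (n ℕ.+ r)))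

sumTo : ℕ → (ℕ → ℤ) → ℤ
sumTo zero f = f zero
sumTo (suc n) f = sumTo n f + f (suc n)

sumFin : (n : ℕ) → (Fin n → ℤ) → ℤ
sumFin zero f = + 0
sumFin (suc n) f = f fzero + sumFin n (λ i → f (fsuc i))

bellSr : (ℕ → Bool) → ℕ → ℕ → ℤ → ℤ
bellSr S r n x = sumTo n (λ k → (+ stirlingSr S r n k) * (x ^ k))

-- T is the inverse of M_{S,r}: Σ_j M(n,j) T(j,k) = δ_{nk}
-- (the sum is over j ≤ n since M_{S,r} is lower triangular)
kronecker : ℕ → ℕ → ℤ
kronecker n k = if n ≡ᵇ k then + 1 else + 0

IsInverseOf-M : (ℕ → Bool) → ℕ → (ℕ → ℕ → ℤ) → Set
IsInverseOf-M S r T =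
  ∀ n k → sumTo n (λ j → (+ stirlingSr S r n j) * T j k) ≡ kronecker n k

det : (n : ℕ) → (Fin n → Fin n → ℤ) → ℤ
det zero A = + 1
det (suc n) A =
  sumFin (suc n) (λ j → ((- + 1) ^ toℕ j) * (A fzero j * det n (λ i l → A (fsuc i) (punchIn j l))))

matD : (ℕ → ℕ → ℤ) → (n : ℕ) → ℤ → Fin (suc n) → Fin (suc n) → ℤ
matD T n x fzero j = x ^ toℕ j
matD T n x (fsuc k) j = T (toℕ j) (toℕ k)

-- Write M = 𝕄_{S,r} and T = M⁻¹.  Since 1 ∈ S, M is lower unitriangular, and
-- hence so is T.  The matrix D has first row (1, x, …, xⁿ) and below it the
-- rows U k = (T(0,k), …, T(n,k)) for k < n, which form an n × (n+1) matrix in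
-- unit row-echelon form (zero left of the diagonal, one on it).  The vector
-- v = (M(n,0), …, M(n,n)) is annihilated by every row of U, because row n of
-- M T = I vanishes in the columns k < n, and its last entry is M(n,n) = 1.
-- The key linear-algebra lemma (det-nullVector) says that for such U and v,
-- det (y over U) = (-1)ⁿ · ⟨y, v⟩ for every first row y; it is proved by
-- induction on n, expanding along the first row.  With y = (xʲ)ⱼ the pairing
-- ⟨y, v⟩ is exactly B_{n,S,r}(x).

module Submission where

open import Defs

open import Data.Bool using (Bool; true; false; _∧_; if_then_else_; _≟_)
open import Data.Bool.Properties using (∧-assoc)
open import Data.Nat as ℕ using (ℕ; zero; suc; _≤_; _<_; z≤n; s≤s; _≤ᵇ_; _≡ᵇ_)
open import Data.Nat.Properties as ℕP using (≤-refl; <-trans; <⇒≢; >⇒≢)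
open import Data.Nat.Induction using (<-rec)
open import Data.Integer using (ℤ; +_; -_; _*_; _+_; _-_; _^_)
open import Data.Integer.Properties as ℤP using ()
open import Data.Integer.Tactic.RingSolver using (solve-∀)
open import Data.Fin using (Fin; toℕ; punchIn; fromℕ; inject₁) renaming (zero to fzero; suc to fsuc)
open import Data.Fin.Properties using (toℕ-fromℕ; toℕ-inject₁; toℕ<n)
open import Data.List using (List; []; _∷_; [_]; _++_; length; map; concatMap; filter)
open import Data.List.Relation.Unary.All as All using (All; []; _∷_)
open import Data.List.Relation.Unary.All.Properties using (map⁺; concat⁺)
open import Data.Empty using (⊥-elim)
open import Function using (_∘_)
open import Relation.Binary.PropositionalEquality hiding ([_])

sumFin-cong : ∀ n {f g : Fin n → ℤ} → (∀ i → f i ≡ g i) → sumFin n f ≡ sumFin n g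
sumFin-cong zero    eq = refl
sumFin-cong (suc n) eq = cong₂ _+_ (eq fzero) (sumFin-cong n (eq ∘ fsuc))

sumFin-zero : ∀ n (f : Fin n → ℤ) → (∀ i → f i ≡ + 0) → sumFin n f ≡ + 0
sumFin-zero zero    f eq = refl
sumFin-zero (suc n) f eq rewrite eq fzero | sumFin-zero n (f ∘ fsuc) (eq ∘ fsuc) = refl

sumFin-neg : ∀ n (f : Fin n → ℤ) → sumFin n (λ i → - f i) ≡ - sumFin n f
sumFin-neg zero    f = refl
sumFin-neg (suc n) f rewrite sumFin-neg n (f ∘ fsuc) = sym (ℤP.neg-distrib-+ (f fzero) _)

sumTo-shift : ∀ n (f : ℕ → ℤ) → sumTo (suc n) f ≡ f 0 + sumTo n (f ∘ suc)
sumTo-shift zero    f = refl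
sumTo-shift (suc n) f = trans (cong (_+ f (suc (suc n))) (sumTo-shift n f)) (ℤP.+-assoc (f 0) _ _)

sumFin-sumTo : ∀ n (f : ℕ → ℤ) → sumFin (suc n) (f ∘ toℕ) ≡ sumTo n f
sumFin-sumTo zero    f = ℤP.+-identityʳ (f 0)
sumFin-sumTo (suc n) f = trans (cong (λ s → f 0 + s) (sumFin-sumTo n (f ∘ suc))) (sym (sumTo-shift n f))

sumTo-zero : ∀ j (f : ℕ → ℤ) → (∀ i → i ≤ j → f i ≡ + 0) → sumTo j f ≡ + 0
sumTo-zero zero    f eq = eq 0 z≤n
sumTo-zero (suc j) f eq
  rewrite sumTo-zero j f (λ i i≤j → eq i (ℕP.m≤n⇒m≤1+n i≤j)) | eq (suc j) ≤-refl = refl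

sumTo-lastTerm : ∀ j (f : ℕ → ℤ) → (∀ i → i < j → f i ≡ + 0) → sumTo j f ≡ f j
sumTo-lastTerm zero    f eq = refl
sumTo-lastTerm (suc j) f eq
  rewrite sumTo-zero j f (λ i i≤j → eq i (s≤s i≤j)) = ℤP.+-identityˡ (f (suc j))

sign-twice : ∀ n a → ((- + 1) ^ n) * (((- + 1) ^ n) * a) ≡ a
sign-twice zero    a = trans (ℤP.*-identityˡ _) (ℤP.*-identityˡ a)
sign-twice (suc n) a = trans (square-neg ((- + 1) ^ n) a) (sign-twice n a)
  where
  square-neg : ∀ p a → ((- + 1) * p) * (((- + 1) * p) * a) ≡ p * (p * a)
  square-neg = solve-∀

kronecker-refl : ∀ k → kronecker k k ≡ + 1
kronecker-refl zero    = refl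
kronecker-refl (suc k) = kronecker-refl k

≡ᵇ-false : ∀ n k → n ≢ k → (n ≡ᵇ k) ≡ false
≡ᵇ-false zero    zero    n≢k = ⊥-elim (n≢k refl)
≡ᵇ-false zero    (suc k) n≢k = refl
≡ᵇ-false (suc n) zero    n≢k = refl
≡ᵇ-false (suc n) (suc k) n≢k = ≡ᵇ-false n k (n≢k ∘ cong suc)

kronecker-≢ : ∀ n k → n ≢ k → kronecker n k ≡ + 0
kronecker-≢ n k n≢k = cong (λ b → if b then + 1 else + 0) (≡ᵇ-false n k n≢k)

-- If M has unit diagonal, is lower triangular (only j ≤ n enters row n of M T)
-- and T is a right inverse of M, then T is lower unitriangular as well.
module UnitriangularInverse
  (M T : ℕ → ℕ → ℤ)
  (M-diag : ∀ n → M n n ≡ + 1)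
  (M-inv : ∀ n k → sumTo n (λ j → M n j * T j k) ≡ kronecker n k)
  where

  inverse-row : ∀ j k → (∀ i → i < j → T i k ≡ + 0) → T j k ≡ kronecker j k
  inverse-row j k above = begin
    T j k                            ≡⟨ sym (ℤP.*-identityˡ (T j k)) ⟩
    + 1 * T j k                      ≡⟨ cong (_* T j k) (sym (M-diag j)) ⟩
    M j j * T j k                    ≡⟨ sym (sumTo-lastTerm j _ vanish) ⟩
    sumTo j (λ i → M j i * T i k)    ≡⟨ M-inv j k ⟩
    kronecker j k                    ∎
    where
    open ≡-Reasoning
    vanish : ∀ i → i < j → M j i * T i k ≡ + 0
    vanish i i<j = trans (cong (M j i *_) (above i i<j)) (ℤP.*-zeroʳ (M j i))

  T-upper : ∀ k j → j < k → T j k ≡ + 0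
  T-upper k = <-rec (λ j → j < k → T j k ≡ + 0) step
    where
    step : ∀ j → (∀ {i} → i < j → i < k → T i k ≡ + 0) → j < k → T j k ≡ + 0
    step j ih j<k = trans (inverse-row j k (λ i i<j → ih i<j (<-trans i<j j<k)))
                          (kronecker-≢ j k (<⇒≢ j<k))

  T-diag : ∀ k → T k k ≡ + 1
  T-diag k = trans (inverse-row k k (λ i → T-upper k i)) (kronecker-refl k)

det-cong : ∀ n {A B : Fin n → Fin n → ℤ} → (∀ i j → A i j ≡ B i j) → det n A ≡ det n B
det-cong zero    eq = refl
det-cong (suc n) eq = sumFin-cong (suc n) λ j →
  cong₂ (λ a d → ((- + 1) ^ toℕ j) * (a * d)) (eq fzero j) (det-cong n (λ i l → eq (fsuc i) (punchIn j l)))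

-- The term of A₀ⱼ (j > 0) in the first-row expansion: its minor keeps the
-- first column of the rows below row 0.
expansionTerm : ∀ k → (Fin (suc k) → Fin (suc k) → ℤ) → Fin k → ℤ
expansionTerm k B m = ((- + 1) ^ toℕ (fsuc m)) * (B fzero (fsuc m) * det k (λ i l → B (fsuc i) (punchIn (fsuc m) l)))

det-zeroColumn : ∀ n (A : Fin (suc n) → Fin (suc n) → ℤ) → (∀ i → A i fzero ≡ + 0) → det (suc n) A ≡ + 0
expansionTerm-zero : ∀ k (B : Fin (suc k) → Fin (suc k) → ℤ) → (∀ i → B (fsuc i) fzero ≡ + 0) →
  ∀ m → expansionTerm k B m ≡ + 0

det-zeroColumn n A zeroCol = sumFin-zero (suc n) _ term-zero
  where
  term-zero : ∀ j → ((- + 1) ^ toℕ j) * (A fzero j * det n (λ i l → A (fsuc i) (punchIn j l))) ≡ + 0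
  term-zero fzero rewrite zeroCol fzero = ℤP.*-zeroʳ (+ 1)
  term-zero (fsuc m) = expansionTerm-zero n A (zeroCol ∘ fsuc) m

expansionTerm-zero (suc k) B zeroCol m
  rewrite det-zeroColumn k (λ i l → B (fsuc i) (punchIn (fsuc m) l)) zeroCol
        | ℤP.*-zeroʳ (B fzero (fsuc m)) = ℤP.*-zeroʳ ((- + 1) ^ toℕ (fsuc m))

det-unitColumn : ∀ n (A : Fin (suc n) → Fin (suc n) → ℤ) → A fzero fzero ≡ + 1 → (∀ i → A (fsuc i) fzero ≡ + 0) →
  det (suc n) A ≡ det n (λ i l → A (fsuc i) (fsuc l))
det-unitColumn n A one zeroBelow = begin
    + 1 * (A fzero fzero * minor) + sumFin n (expansionTerm n A)
  ≡⟨ cong₂ (λ a b → + 1 * (a * minor) + b) one (sumFin-zero n _ (expansionTerm-zero n A zeroBelow)) ⟩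
    + 1 * (+ 1 * minor) + + 0
  ≡⟨ trans (ℤP.+-identityʳ _) (trans (ℤP.*-identityˡ _) (ℤP.*-identityˡ minor)) ⟩
    minor
  ∎
  where
  open ≡-Reasoning
  minor = det n (λ i l → A (fsuc i) (fsuc l))

withFirstRow : ∀ {n} → (Fin (suc n) → ℤ) → (Fin n → Fin (suc n) → ℤ) → Fin (suc n) → Fin (suc n) → ℤ
withFirstRow y U fzero    = y
withFirstRow y U (fsuc k) = U k

corner : ∀ {m n} → (Fin (suc m) → Fin (suc n) → ℤ) → Fin m → Fin n → ℤ
corner U k l = U (fsuc k) (fsuc l)

dot : ∀ {n} → (Fin n → ℤ) → (Fin n → ℤ) → ℤ
dot {n} y v = sumFin n (λ l → y l * v l)

det-firstRowStep : ∀ n (y : Fin (suc (suc n)) → ℤ) (U : Fin (suc n) → Fin (suc (suc n)) → ℤ) →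
  U fzero fzero ≡ + 1 → (∀ k → U (fsuc k) fzero ≡ + 0) →
  det (suc (suc n)) (withFirstRow y U)
    ≡ y fzero * det (suc n) (withFirstRow (U fzero ∘ fsuc) (corner U)) - det (suc n) (withFirstRow (y ∘ fsuc) (corner U))
det-firstRowStep n y U one zeroBelow = begin
    det (suc (suc n)) (withFirstRow y U)
  ≡⟨⟩
    + 1 * (y fzero * det (suc n) (λ i l → U i (fsuc l))) + sumFin (suc n) (λ j → term (fsuc j))
  ≡⟨ cong₂ (λ a b → + 1 * (y fzero * a) + b) (det-cong (suc n) firstMinor) (sumFin-cong (suc n) otherMinor) ⟩
    + 1 * (y fzero * det (suc n) (withFirstRow (U fzero ∘ fsuc) (corner U))) + sumFin (suc n) (λ j → - term′ j)
  ≡⟨ cong₂ _+_ (ℤP.*-identityˡ (y fzero * det (suc n) (withFirstRow (U fzero ∘ fsuc) (corner U)))) (sumFin-neg (suc n) term′) ⟩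
    y fzero * det (suc n) (withFirstRow (U fzero ∘ fsuc) (corner U)) - det (suc n) (withFirstRow (y ∘ fsuc) (corner U))
  ∎
  where
  open ≡-Reasoning
  term : Fin (suc (suc n)) → ℤ
  term j = ((- + 1) ^ toℕ j) * (y j * det (suc n) (λ i l → U i (punchIn j l)))
  term′ : Fin (suc n) → ℤ
  term′ j = ((- + 1) ^ toℕ j) * (y (fsuc j) * det n (λ i l → corner U i (punchIn j l)))
  firstMinor : ∀ i l → U i (fsuc l) ≡ withFirstRow (U fzero ∘ fsuc) (corner U) i l
  firstMinor fzero    l = refl
  firstMinor (fsuc i) l = refl
  minus : ∀ p a → ((- + 1) * p) * a ≡ - (p * a)
  minus = solve-∀
  otherMinor : ∀ j → term (fsuc j) ≡ - term′ j
  otherMinor j = trans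
    (cong (λ d → ((- + 1) ^ toℕ (fsuc j)) * (y (fsuc j) * d))
          (det-unitColumn n (λ i l → U i (punchIn (fsuc j) l)) one zeroBelow))
    (minus ((- + 1) ^ toℕ j) _)

record UnitEchelon {n} (U : Fin n → Fin (suc n) → ℤ) : Set where
  field
    left-zero : ∀ k l → toℕ l < toℕ k → U k l ≡ + 0
    diag-one  : ∀ k → U k (inject₁ k) ≡ + 1
open UnitEchelon

UnitEchelon-corner : ∀ {n} {U : Fin (suc n) → Fin (suc (suc n)) → ℤ} → UnitEchelon U → UnitEchelon (corner U)
UnitEchelon-corner E .left-zero k l l<k = E .left-zero (fsuc k) (fsuc l) (s≤s l<k)
UnitEchelon-corner E .diag-one k = E .diag-one (fsuc k)

det-nullVector : ∀ n (y v : Fin (suc n) → ℤ) (U : Fin n → Fin (suc n) → ℤ) →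
  UnitEchelon U → (∀ k → dot (U k) v ≡ + 0) → v (fromℕ n) ≡ + 1 →
  det (suc n) (withFirstRow y U) ≡ ((- + 1) ^ n) * dot y v
det-nullVector zero y v U E null vₙ rewrite vₙ = base (y fzero)
  where
  base : ∀ a → + 1 * (a * + 1) + + 0 ≡ + 1 * (a * + 1 + + 0)
  base = solve-∀
det-nullVector (suc n) y v U E null vₙ = begin
    det (suc (suc n)) (withFirstRow y U)
  ≡⟨ det-firstRowStep n y U (E .diag-one fzero) zeroBelow ⟩
    y fzero * det (suc n) (withFirstRow (U fzero ∘ fsuc) V) - det (suc n) (withFirstRow (y ∘ fsuc) V)
  ≡⟨ cong₂ (λ a b → y fzero * a - b) (recurse (U fzero ∘ fsuc)) (recurse (y ∘ fsuc)) ⟩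
    y fzero * (p * dot (U fzero ∘ fsuc) (v ∘ fsuc)) - p * dot (y ∘ fsuc) (v ∘ fsuc)
  ≡⟨ cong (λ s → y fzero * (p * s) - p * dot (y ∘ fsuc) (v ∘ fsuc)) firstRowTail ⟩
    y fzero * (p * - v fzero) - p * dot (y ∘ fsuc) (v ∘ fsuc)
  ≡⟨ collect (y fzero) (v fzero) p _ ⟩
    ((- + 1) * p) * (y fzero * v fzero + dot (y ∘ fsuc) (v ∘ fsuc))
  ∎
  where
  open ≡-Reasoning
  p = (- + 1) ^ n
  V = corner U
  zeroBelow : ∀ k → U (fsuc k) fzero ≡ + 0
  zeroBelow k = E .left-zero (fsuc k) fzero (s≤s z≤n)
  -- rows of V still annihilate the tail of v, since U (fsuc k) has first entry 0
  nullV : ∀ k → dot (V k) (v ∘ fsuc) ≡ + 0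
  nullV k = trans (sym (ℤP.+-identityˡ _))
    (trans (cong (λ a → a * v fzero + dot (V k) (v ∘ fsuc)) (sym (zeroBelow k))) (null (fsuc k)))
  recurse : ∀ z → det (suc n) (withFirstRow z V) ≡ p * dot z (v ∘ fsuc)
  recurse z = det-nullVector n z (v ∘ fsuc) V (UnitEchelon-corner E) nullV vₙ
  -- row 0 of U annihilates v and starts with 1
  firstRowTail : dot (U fzero ∘ fsuc) (v ∘ fsuc) ≡ - v fzero
  firstRowTail = begin
    dot (U fzero ∘ fsuc) (v ∘ fsuc)                       ≡⟨ cancel (v fzero) _ ⟩
    - v fzero + (+ 1 * v fzero + dot (U fzero ∘ fsuc) (v ∘ fsuc))
        ≡⟨ cong (λ a → - v fzero + (a * v fzero + dot (U fzero ∘ fsuc) (v ∘ fsuc))) (sym (E .diag-one fzero)) ⟩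
    - v fzero + dot (U fzero) v                           ≡⟨ cong (λ s → - v fzero + s) (null fzero) ⟩
    - v fzero + + 0                                       ≡⟨ ℤP.+-identityʳ _ ⟩
    - v fzero                                             ∎
    where
    cancel : ∀ a s → s ≡ - a + (+ 1 * a + s)
    cancel = solve-∀
  collect : ∀ y₀ v₀ p s → y₀ * (p * - v₀) - p * s ≡ ((- + 1) * p) * (y₀ * v₀ + s)
  collect = solve-∀

-- {n brace n}_{S,r} = 1: a partition of [m] into m blocks is the partition
-- into singletons, which is admissible as soon as 1 ∈ S.

boolToℕ : Bool → ℕ
boolToℕ true  = 1
boolToℕ false = 0

count : {A : Set} → (A → Bool) → List A → ℕ
count P []       = 0
count P (a ∷ as) = boolToℕ (P a) ℕ.+ count P as

length-filter : {A : Set} (P : A → Bool) (xs : List A) → length (filter (λ a → P a ≟ true) xs) ≡ count P xs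
length-filter P []       = refl
length-filter P (x ∷ xs) with P x
... | true  = cong suc (length-filter P xs)
... | false = length-filter P xs

count-++ : {A : Set} (P : A → Bool) (xs ys : List A) → count P (xs ++ ys) ≡ count P xs ℕ.+ count P ys
count-++ P []       ys = refl
count-++ P (x ∷ xs) ys = trans (cong (boolToℕ (P x) ℕ.+_) (count-++ P xs ys)) (sym (ℕP.+-assoc (boolToℕ (P x)) _ _))

count-map : {A B : Set} (P : B → Bool) (f : A → B) (xs : List A) → count P (map f xs) ≡ count (P ∘ f) xs
count-map P f []       = refl
count-map P f (x ∷ xs) = cong (boolToℕ (P (f x)) ℕ.+_) (count-map P f xs)

insertElem-blocks : ∀ x p → All (λ q → length q ≤ suc (length p)) (insertElem x p)
insertElem-blocks x []       = s≤s z≤n ∷ []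
insertElem-blocks x (b ∷ bs) = s≤s (ℕP.n≤1+n _) ∷ map⁺ (All.map s≤s (insertElem-blocks x bs))

partitions-blocks : ∀ m → All (λ p → length p ≤ m) (partitions m)
partitions-blocks zero    = z≤n ∷ []
partitions-blocks (suc m) = concat⁺ (map⁺ (All.map extend (partitions-blocks m)))
  where
  extend : ∀ {p} → length p ≤ m → All (λ q → length q ≤ suc m) (insertElem (suc m) p)
  extend p≤m = All.map (λ q≤ → ℕP.≤-trans q≤ (s≤s p≤m)) (insertElem-blocks (suc m) _)

-- Counting insertions of x into p (with ≤ m blocks) that have m+1 blocks and
-- satisfy Q: only the new singleton block can qualify, and only if p has m blocks.
count-insertElem : ∀ x p m (Q : List (List ℕ) → Bool) → length p ≤ m →
  count (λ q → (length q ≡ᵇ suc m) ∧ Q q) (insertElem x p) ≡ boolToℕ ((length p ≡ᵇ m) ∧ Q (p ++ [ [ x ] ]))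
count-insertElem x []       m       Q _ = ℕP.+-identityʳ _
count-insertElem x (b ∷ bs) (suc m) Q (s≤s bs≤m)
  rewrite ≡ᵇ-false (length bs) (suc m) (<⇒≢ (s≤s bs≤m)) =
    trans (count-map (λ q → (length q ≡ᵇ suc (suc m)) ∧ Q q) (b ∷_) (insertElem x bs))
          (count-insertElem x bs m (Q ∘ (b ∷_)) bs≤m)

count-extensions : ∀ m (Q : List (List ℕ) → Bool) (ps : List (List (List ℕ))) → All (λ p → length p ≤ m) ps →
  count (λ q → (length q ≡ᵇ suc m) ∧ Q q) (concatMap (insertElem (suc m)) ps)
    ≡ count (λ p → (length p ≡ᵇ m) ∧ Q (p ++ [ [ suc m ] ])) ps
count-extensions m Q []       []           = refl
count-extensions m Q (p ∷ ps) (p≤m ∷ ps≤m) =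
  trans (count-++ _ (insertElem (suc m) p) (concatMap (insertElem (suc m)) ps))
        (cong₂ ℕ._+_ (count-insertElem (suc m) p m Q p≤m) (count-extensions m Q ps ps≤m))

-- The partition {1}, {2}, …, {m}, in the order the enumeration produces it.
singletons : ℕ → List (List ℕ)
singletons zero    = []
singletons (suc m) = singletons m ++ [ [ suc m ] ]

count-maxBlocks : ∀ m (Q : List (List ℕ) → Bool) →
  count (λ p → (length p ≡ᵇ m) ∧ Q p) (partitions m) ≡ boolToℕ (Q (singletons m))
count-maxBlocks zero    Q = ℕP.+-identityʳ _
count-maxBlocks (suc m) Q =
  trans (count-extensions m Q (partitions m) (partitions-blocks m)) (count-maxBlocks m (λ p → Q (p ++ [ [ suc m ] ])))

allB-++ : {A : Set} (P : A → Bool) (xs ys : List A) → allB P (xs ++ ys) ≡ allB P xs ∧ allB P ys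
allB-++ P []       ys = refl
allB-++ P (x ∷ xs) ys rewrite allB-++ P xs ys = sym (∧-assoc (P x) _ _)

allB-singletons : (P : List ℕ → Bool) → (∀ i → P [ i ] ≡ true) → ∀ m → allB P (singletons m) ≡ true
allB-singletons P P-single zero    = refl
allB-singletons P P-single (suc m)
  rewrite allB-++ P (singletons m) [ [ suc m ] ] | allB-singletons P P-single m | P-single (suc m) = refl

countLe-singleton : ∀ r i → (countLe r [ i ] ≤ᵇ 1) ≡ true
countLe-singleton r i with i ≤ᵇ r
... | true  = refl
... | false = refl

stirlingSr-diag : (S : ℕ → Bool) → S 1 ≡ true → ∀ r n → stirlingSr S r n n ≡ 1
stirlingSr-diag S S1 r n =
  trans (length-filter (admissible S r n) (partitions (n ℕ.+ r)))
    (trans (count-maxBlocks (n ℕ.+ r) (λ p → allB (λ b → S (length b)) p ∧ allB (λ b → countLe r b ≤ᵇ 1) p))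
      (cong boolToℕ (cong₂ _∧_ (allB-singletons _ (λ _ → S1) (n ℕ.+ r))
                               (allB-singletons _ (countLe-singleton r) (n ℕ.+ r)))))

module BellData (S : ℕ → Bool) (S1 : S 1 ≡ true) (r : ℕ) (T : ℕ → ℕ → ℤ) (T-inv : IsInverseOf-M S r T) where

  M : ℕ → ℕ → ℤ
  M n j = + stirlingSr S r n j

  open UnitriangularInverse M T (λ n → cong +_ (stirlingSr-diag S S1 r n)) T-inv

  inverseRows : ∀ n → Fin n → Fin (suc n) → ℤ
  inverseRows n k l = T (toℕ l) (toℕ k)

  lastRow : ∀ n → Fin (suc n) → ℤ
  lastRow n l = M n (toℕ l)

  -- By triangularity of T, the rows U k form a unit row-echelon matrix.
  inverseRows-echelon : ∀ n → UnitEchelon (inverseRows n)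
  inverseRows-echelon n .left-zero k l l<k = T-upper (toℕ k) (toℕ l) l<k
  inverseRows-echelon n .diag-one k rewrite toℕ-inject₁ k = T-diag (toℕ k)

  -- Row n of M T = I vanishes in every column k < n.
  inverseRows-annihilate : ∀ n k → dot (inverseRows n k) (lastRow n) ≡ + 0
  inverseRows-annihilate n k = begin
    dot (inverseRows n k) (lastRow n)               ≡⟨ sumFin-cong (suc n) (λ l → ℤP.*-comm (T (toℕ l) (toℕ k)) (M n (toℕ l))) ⟩
    sumFin (suc n) (λ l → M n (toℕ l) * T (toℕ l) (toℕ k)) ≡⟨ sumFin-sumTo n (λ j → M n j * T j (toℕ k)) ⟩
    sumTo n (λ j → M n j * T j (toℕ k))             ≡⟨ T-inv n (toℕ k) ⟩
    kronecker n (toℕ k)                             ≡⟨ kronecker-≢ n (toℕ k) (>⇒≢ (toℕ<n k)) ⟩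
    + 0                                             ∎
    where open ≡-Reasoning

  lastRow-last : ∀ n → lastRow n (fromℕ n) ≡ + 1
  lastRow-last n rewrite toℕ-fromℕ n = cong +_ (stirlingSr-diag S S1 r n)

  powers : ∀ n → ℤ → Fin (suc n) → ℤ
  powers n x l = x ^ toℕ l

  bell-as-dot : ∀ n x → bellSr S r n x ≡ dot (powers n x) (lastRow n)
  bell-as-dot n x = trans (sym (sumFin-sumTo n (λ k → M n k * x ^ k)))
                          (sumFin-cong (suc n) (λ l → ℤP.*-comm (M n (toℕ l)) (x ^ toℕ l)))

  matD-withFirstRow : ∀ n x i j → withFirstRow (powers n x) (inverseRows n) i j ≡ matD T n x i j
  matD-withFirstRow n x fzero    j = refl
  matD-withFirstRow n x (fsuc k) j = refl

-- B_{n,S,r}(x) = (-1)ⁿ det D, by det-nullVector applied to U and v.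
mainTheorem9 : (S : ℕ → Bool) → S 1 ≡ true → (r n : ℕ) → 1 ≤ n →
    (T : ℕ → ℕ → ℤ) → IsInverseOf-M S r T → (x : ℤ) →
    bellSr S r n x ≡ ((- + 1) ^ n) * det (suc n) (matD T n x)
mainTheorem9 S S1 r n _ T T-inv x = begin
    bellSr S r n x
  ≡⟨ bell-as-dot n x ⟩
    dot (powers n x) (lastRow n)
  ≡⟨ sym (sign-twice n _) ⟩
    p * (p * dot (powers n x) (lastRow n))
  ≡⟨ cong (p *_) (sym (det-nullVector n (powers n x) (lastRow n) (inverseRows n)
                        (inverseRows-echelon n) (inverseRows-annihilate n) (lastRow-last n))) ⟩
    p * det (suc n) (withFirstRow (powers n x) (inverseRows n))
  ≡⟨ cong (p *_) (det-cong (suc n) (matD-withFirstRow n x)) ⟩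
    p * det (suc n) (matD T n x)
  ∎
  where
  open ≡-Reasoning
  open BellData S S1 r T T-inv
  p = (- + 1) ^ n
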